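{- Let $s$ and $k\ge 4$ be positive integers and $n=2sk+1$. Then the circle graph $D$ on $n$ vertices determined by the set of even integers $\{2,4,6,\ldots,2s\}$ has no diameter two subgraph on more than $2s+1$ vertices.
   Context: For an integer $n\ge 2$ and a set $S\subseteq\{1,\ldots,\lfloor n/2\rfloor\}$, the circle graph on $n$ vertices determined by $S$ is the graph with vertex set $\{0,1,\ldots,n-1\}$ in which two vertices $x,y$ are adjacent if and only if $(x-y)\bmod n\in S$ or $(y-x)\bmod n\in S$. A diameter two subgraph of a graph $G$ is a subgraph $H$ of $G$ such that for every pair of vertices $x,y$ of $H$ there is a path in $H$ joining $x$ and $y$ with at most two edges. -}

module Defs where

open import Data.Nat using (ℕ; suc; _+_; _*_; _∸_; _≤_; NonZero)
open import Data.Nat.DivMod using (_%_)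
open import Data.Fin using (Fin; toℕ)
open import Data.Fin.Subset using (Subset; _∈_)
open import Data.Product using (Σ; ∃; _×_)
open import Data.Sum using (_⊎_)
open import Relation.Binary.PropositionalEquality using (_≡_)

diffMod : (n : ℕ) .{{_ : NonZero n}} → Fin n → Fin n → ℕ
diffMod n x y = (toℕ x + n ∸ toℕ y) % n

CircleAdj : (n : ℕ) .{{_ : NonZero n}} → (ℕ → Set) → Fin n → Fin n → Set
CircleAdj n S x y = S (diffMod n x y) ⊎ S (diffMod n y x)

EvenUpTo : ℕ → ℕ → Set
EvenUpTo s d = ∃ λ j → (1 ≤ j) × (j ≤ s) × (d ≡ 2 * j)

record IsSubgraph {n : ℕ} (Adj : Fin n → Fin n → Set)
                  (V : Subset n) (E : Fin n → Fin n → Set) : Set where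
  field
    edge-sym  : ∀ x y → E x y → E y x
    edge-adj  : ∀ x y → E x y → Adj x y
    edge-domˡ : ∀ x y → E x y → x ∈ V
    edge-domʳ : ∀ x y → E x y → y ∈ V

DiameterTwo : {n : ℕ} → Subset n → (Fin n → Fin n → Set) → Set
DiameterTwo {n} V E =
  ∀ x y → x ∈ V → y ∈ V →
    (x ≡ y) ⊎ E x y ⊎ (Σ (Fin n) λ z → z ∈ V × E x z × E z y)

-- Since N = 2sk + 1 is odd, 2 is invertible modulo N; halving the vertex labels turns every edge
-- of the circle graph (x − y ≡ ±2j, 1 ≤ j ≤ s) into a step of length at most s around ℤ/N.
-- Vertices of a diameter two subgraph are joined by paths of at most two edges, so their halved
-- labels are pairwise within cyclic distance 2s. Because 4 · 2s < N such a set cannot wrap around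
-- the cycle: seen from one of its points it lies in a window of length 4s where cyclic and integer
-- distances agree, so it is a set of integers of diameter at most 2s, with at most 2s + 1 elements.
module Submission where

open import Defs

module SubsetCounting where

  open import Data.Nat using (ℕ; zero; suc; _+_; _∸_; _≤_; _≤?_; z≤n; s≤s)
  open import Data.Nat.Properties using (≤-refl; ≤-trans; ≰⇒≥; m≤n+o⇒m∸n≤o; ∸-cancelʳ-≡)
  open import Data.Fin using (Fin; zero; suc; punchOut; fromℕ<; toℕ)
  open import Data.Fin.Properties using (punchOut-injective; suc-injective; toℕ-fromℕ<)
  open import Data.Fin.Subset using (Subset; ∣_∣; _∈_; inside; outside; Nonempty)
  open import Data.Fin.Subset.Properties using (nonempty?)
  open import Data.Vec.Base using (_∷_; []; here; there)
  open import Data.Product using (Σ; _×_; _,_)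
  open import Data.Empty using (⊥-elim)
  open import Relation.Nullary using (yes; no)
  open import Relation.Binary.PropositionalEquality
    using (_≡_; _≢_; cong; module ≡-Reasoning)

  injectiveOn⇒∣p∣≤ : ∀ {n m} (p : Subset n) (f : ∀ x → x ∈ p → Fin m) →
                     (∀ {x y} px py → f x px ≡ f y py → x ≡ y) → ∣ p ∣ ≤ m
  injectiveOn⇒∣p∣≤ [] f inj = z≤n
  injectiveOn⇒∣p∣≤ (outside ∷ p) f inj =
    injectiveOn⇒∣p∣≤ p (λ x px → f (suc x) (there px))
      (λ px py eq → suc-injective (inj (there px) (there py) eq))
  injectiveOn⇒∣p∣≤ {m = zero} (inside ∷ p) f inj with f zero here
  ... | ()
  injectiveOn⇒∣p∣≤ {m = suc m} (inside ∷ p) f inj = s≤s (injectiveOn⇒∣p∣≤ p g g-injective)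
    where
    f₀≢f : ∀ {x} (px : x ∈ p) → f zero here ≢ f (suc x) (there px)
    f₀≢f px eq with inj here (there px) eq
    ... | ()
    g : ∀ x → x ∈ p → Fin m
    g x px = punchOut (f₀≢f px)
    g-injective : ∀ {x y} px py → g x px ≡ g y py → x ≡ y
    g-injective px py eq =
      suc-injective (inj (there px) (there py) (punchOut-injective (f₀≢f px) (f₀≢f py) eq))

  minimum-∈ : ∀ {n} (p : Subset n) (f : Fin n → ℕ) → Nonempty p →
              Σ (Fin n) λ x → x ∈ p × (∀ {y} → y ∈ p → f x ≤ f y)
  minimum-∈ (outside ∷ p) f (suc x , there px) with minimum-∈ p (λ y → f (suc y)) (x , px)
  ... | y , py , min = suc y , there py , λ { (there pz) → min pz }
  minimum-∈ (inside ∷ p) f _ with nonempty? p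
  ... | no ¬ne = zero , here , λ { here → ≤-refl ; (there py) → ⊥-elim (¬ne (_ , py)) }
  ... | yes ne with minimum-∈ p (λ y → f (suc y)) ne
  ...   | y , py , min with f zero ≤? f (suc y)
  ...     | yes f₀≤ = zero , here , λ { here → ≤-refl ; (there pz) → ≤-trans f₀≤ (min pz) }
  ...     | no f₀≰ = suc y , there py , λ { here → ≰⇒≥ f₀≰ ; (there pz) → min pz }

  spread≤⇒∣p∣≤ : ∀ {n m} (p : Subset n) (f : Fin n → ℕ) → Nonempty p →
                 (∀ {x y} → x ∈ p → y ∈ p → f x ≡ f y → x ≡ y) →
                 (∀ {x y} → x ∈ p → y ∈ p → f x ≤ f y + m) →
                 ∣ p ∣ ≤ suc m
  spread≤⇒∣p∣≤ {m = m} p f ne inj spread with minimum-∈ p f ne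
  ... | x₀ , px₀ , min = injectiveOn⇒∣p∣≤ p offset offset-injective
    where
    offset≤ : ∀ {x} → x ∈ p → f x ∸ f x₀ ≤ m
    offset≤ px = m≤n+o⇒m∸n≤o (f _) (f x₀) (spread px px₀)
    offset : ∀ x → x ∈ p → Fin (suc m)
    offset x px = fromℕ< (s≤s (offset≤ px))
    offset-injective : ∀ {x y} px py → offset x px ≡ offset y py → x ≡ y
    offset-injective px py eq = inj px py (∸-cancelʳ-≡ (min px) (min py) (begin
      f _ ∸ f x₀           ≡⟨ toℕ-fromℕ< (s≤s (offset≤ px)) ⟨
      toℕ (offset _ px)    ≡⟨ cong toℕ eq ⟩
      toℕ (offset _ py)    ≡⟨ toℕ-fromℕ< (s≤s (offset≤ py)) ⟩
      f _ ∸ f x₀           ∎))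
      where open ≡-Reasoning

module ModularArithmetic where

  open import Data.Nat as ℕ using (ℕ; zero; suc; NonZero; z≤n)
  import Data.Nat.Properties as ℕ
  open import Data.Nat.Divisibility as ℕ using (>⇒∤)
  open import Data.Integer
    using (ℤ; +_; -[1+_]; -_; _+_; _-_; _*_; 0ℤ; 1ℤ; ∣_∣; _%ℕ_; _/ℕ_; _≤_; +≤+)
  open import Data.Integer.Properties
    using ( +-injective; i-j≡0⇒i≡j; ∣i∣≡0⇒i≡0; m-n≡m⊖n; ∣m⊝n∣≤m⊔n; ⊖-≥; +-inverseʳ; *-zeroˡ
          ; +-identityʳ; ∣-i∣≡∣i∣; ∣i+j∣≤∣i∣+∣j∣; 0≤i⇒+∣i∣≡i; pos-+; pos-*)
  open import Data.Integer.DivMod using (a≡a%ℕn+[a/ℕn]*n)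
  open import Data.Integer.Divisibility.Signed
    using (_∣_; divides; ∣⇒∣ᵤ; ∣m⇒∣-m; ∣m∣n⇒∣m+n; ∣n⇒∣m*n)
  open import Data.Integer.Tactic.RingSolver using (solve)
  open import Data.List using (_∷_; [])
  open import Data.Empty using (⊥-elim)
  open import Level using (0ℓ)
  open import Relation.Binary.Bundles using (Setoid)
  import Relation.Binary.Reasoning.Setoid as SetoidReasoning
  open import Relation.Binary.PropositionalEquality
    using (_≡_; refl; sym; trans; cong; subst)

  infix 4 _≡_mod_

  -- A record rather than a synonym for + N ∣ x - y, so that x and y can be inferred.
  record _≡_mod_ (x y : ℤ) (N : ℕ) : Set where
    constructor ∣⇒≡-mod
    field ≡-mod⇒∣ : + N ∣ x - y

  open _≡_mod_

  private
    ∣-resp : ∀ {k a b} → k ∣ a → a ≡ b → k ∣ b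
    ∣-resp k∣a refl = k∣a

  ≡⇒≡-mod : ∀ {N} {x y : ℤ} → x ≡ y → x ≡ y mod N
  ≡⇒≡-mod {N} {x} refl = ∣⇒≡-mod (divides 0ℤ (trans (+-inverseʳ x) (sym (*-zeroˡ (+ N)))))

  ≡-mod-refl : ∀ {N} {x : ℤ} → x ≡ x mod N
  ≡-mod-refl = ≡⇒≡-mod refl

  ≡-mod-sym : ∀ {N} {x y : ℤ} → x ≡ y mod N → y ≡ x mod N
  ≡-mod-sym {x = x} {y} (∣⇒≡-mod N∣x-y) =
    ∣⇒≡-mod (∣-resp (∣m⇒∣-m N∣x-y) (solve (x ∷ y ∷ [])))

  ≡-mod-trans : ∀ {N} {x y z : ℤ} → x ≡ y mod N → y ≡ z mod N → x ≡ z mod N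
  ≡-mod-trans {x = x} {y} {z} (∣⇒≡-mod N∣x-y) (∣⇒≡-mod N∣y-z) =
    ∣⇒≡-mod (∣-resp (∣m∣n⇒∣m+n N∣x-y N∣y-z) (solve (x ∷ y ∷ z ∷ [])))

  ≡-mod-setoid : ℕ → Setoid 0ℓ 0ℓ
  ≡-mod-setoid N = record
    { Carrier       = ℤ
    ; _≈_           = λ x y → x ≡ y mod N
    ; isEquivalence = record
      { refl  = ≡-mod-refl
      ; sym   = ≡-mod-sym
      ; trans = ≡-mod-trans
      }
    }

  module ≡-mod-Reasoning (N : ℕ) = SetoidReasoning (≡-mod-setoid N)

  +-congˡ-mod : ∀ {N} {x y : ℤ} z → x ≡ y mod N → z + x ≡ z + y mod N
  +-congˡ-mod {x = x} {y} z (∣⇒≡-mod N∣x-y) = ∣⇒≡-mod (∣-resp N∣x-y (solve (x ∷ y ∷ z ∷ [])))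

  +-congʳ-mod : ∀ {N} {x y : ℤ} z → x ≡ y mod N → x + z ≡ y + z mod N
  +-congʳ-mod {x = x} {y} z (∣⇒≡-mod N∣x-y) = ∣⇒≡-mod (∣-resp N∣x-y (solve (x ∷ y ∷ z ∷ [])))

  *-congˡ-mod : ∀ {N} {x y : ℤ} z → x ≡ y mod N → z * x ≡ z * y mod N
  *-congˡ-mod {x = x} {y} z (∣⇒≡-mod N∣x-y) =
    ∣⇒≡-mod (∣-resp (∣n⇒∣m*n z N∣x-y) (solve (x ∷ y ∷ z ∷ [])))

  +-multiple-mod : ∀ {N} x z → x + z * + N ≡ x mod N
  +-multiple-mod {N} x z = ∣⇒≡-mod (divides z (cancel (+ N)))
    where
    cancel : ∀ n → x + z * n - x ≡ z * n
    cancel n = solve (x ∷ z ∷ n ∷ [])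

  +-cancelʳ-mod : ∀ {N} {x y : ℤ} z → x + z ≡ y + z mod N → x ≡ y mod N
  +-cancelʳ-mod {x = x} {y} z (∣⇒≡-mod N∣x+z-[y+z]) =
    ∣⇒≡-mod (∣-resp N∣x+z-[y+z] (solve (x ∷ y ∷ z ∷ [])))

  %ℕ-≡-mod : ∀ {N} .{{_ : NonZero N}} x → + (x %ℕ N) ≡ x mod N
  %ℕ-≡-mod {N} x = begin
    + (x %ℕ N)                     ≈⟨ +-multiple-mod (+ (x %ℕ N)) (x /ℕ N) ⟨
    + (x %ℕ N) + (x /ℕ N) * + N    ≡⟨ a≡a%ℕn+[a/ℕn]*n x N ⟨
    x                              ∎
    where open ≡-mod-Reasoning N

  ≡-mod⇒≡ : ∀ {N a b} → a ℕ.< N → b ℕ.< N → + a ≡ + b mod N → a ≡ b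
  ≡-mod⇒≡ {N} {a} {b} a<N b<N a≡b =
    +-injective (i-j≡0⇒i≡j (+ a) (+ b) (∣i∣≡0⇒i≡0 (small-multiple≡0 ∣a-b∣<N (∣⇒∣ᵤ (≡-mod⇒∣ a≡b)))))
    where
    ∣a-b∣<N : ∣ + a - + b ∣ ℕ.< N
    ∣a-b∣<N = subst (ℕ._< N) (cong ∣_∣ (sym (m-n≡m⊖n a b)))
                (ℕ.≤-<-trans (∣m⊝n∣≤m⊔n a b) (ℕ.⊔-lub a<N b<N))
    small-multiple≡0 : ∀ {d} → d ℕ.< N → N ℕ.∣ d → d ≡ 0
    small-multiple≡0 {zero}  _   _   = refl
    small-multiple≡0 {suc _} d<N N∣d = ⊥-elim (>⇒∤ d<N N∣d)

  record Near (N b : ℕ) (x y : ℤ) : Set where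
    constructor near
    field
      offset        : ℤ
      ∣offset∣≤b    : ∣ offset ∣ ℕ.≤ b
      x≡y+offset    : x ≡ y + offset mod N

  near-refl : ∀ {N b x} → Near N b x x
  near-refl {x = x} = near 0ℤ z≤n (≡⇒≡-mod (sym (+-identityʳ x)))

  near-sym : ∀ {N b x y} → Near N b x y → Near N b y x
  near-sym {N} {x = x} {y} (near t ∣t∣≤b x≡y+t) =
    near (- t) (subst (ℕ._≤ _) (sym (∣-i∣≡∣i∣ t)) ∣t∣≤b) (begin
    y              ≡⟨ solve (y ∷ t ∷ []) ⟩
    (y + t) + - t  ≈⟨ +-congʳ-mod (- t) x≡y+t ⟨
    x + - t        ∎)
    where open ≡-mod-Reasoning N

  near-trans : ∀ {N b c x y z} → Near N b x y → Near N c y z → Near N (b ℕ.+ c) x z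
  near-trans {N} {x = x} {y} {z} (near t ∣t∣≤b x≡y+t) (near u ∣u∣≤c y≡z+u) =
    near (t + u) (ℕ.≤-trans (∣i+j∣≤∣i∣+∣j∣ t u) (ℕ.+-mono-≤ ∣t∣≤b ∣u∣≤c)) (begin
    x              ≈⟨ x≡y+t ⟩
    y + t          ≈⟨ +-congʳ-mod t y≡z+u ⟩
    (z + u) + t    ≡⟨ solve (z ∷ t ∷ u ∷ []) ⟩
    z + (t + u)    ∎)
    where open ≡-mod-Reasoning N

  near-mono : ∀ {N b c x y} → b ℕ.≤ c → Near N b x y → Near N c x y
  near-mono b≤c (near t ∣t∣≤b x≡y+t) = near t (ℕ.≤-trans ∣t∣≤b b≤c) x≡y+t

  near-resp : ∀ {N b x x′ y y′} → x ≡ x′ mod N → y ≡ y′ mod N → Near N b x y → Near N b x′ y′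
  near-resp {N} {x = x} {x′} {y} {y′} x≡x′ y≡y′ (near t ∣t∣≤b x≡y+t) = near t ∣t∣≤b (begin
    x′      ≈⟨ x≡x′ ⟨
    x       ≈⟨ x≡y+t ⟩
    y + t   ≈⟨ +-congʳ-mod t y≡y′ ⟩
    y′ + t  ∎)
    where open ≡-mod-Reasoning N

  near-translate : ∀ {N b x y} z → Near N b x y → Near N b (x + z) (y + z)
  near-translate {N} {x = x} {y} z (near t ∣t∣≤b x≡y+t) = near t ∣t∣≤b (begin
    x + z          ≈⟨ +-congʳ-mod z x≡y+t ⟩
    (y + t) + z    ≡⟨ solve (y ∷ z ∷ t ∷ []) ⟩
    (y + z) + t    ∎)
    where open ≡-mod-Reasoning N

  near⇒≤ : ∀ {N a b c} → b ℕ.≤ c → c ℕ.+ b ℕ.< N → a ℕ.< N →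
           Near N b (+ a) (+ c) → a ℕ.≤ c ℕ.+ b
  near⇒≤ {N} {a} {b} {c} b≤c c+b<N a<N (near t ∣t∣≤b a≡c+t) = subst (ℕ._≤ c ℕ.+ b) (sym a≡u) u≤c+b
    where
    u : ℕ
    u = ∣ + c + t ∣
    0≤c+t : ∀ t → ∣ t ∣ ℕ.≤ c → 0ℤ ≤ + c + t
    0≤c+t (+ _)    _     = +≤+ z≤n
    0≤c+t -[1+ _ ] ∣t∣≤c = subst (0ℤ ≤_) (sym (⊖-≥ ∣t∣≤c)) (+≤+ z≤n)
    u≡c+t : + u ≡ + c + t
    u≡c+t = 0≤i⇒+∣i∣≡i (0≤c+t t (ℕ.≤-trans ∣t∣≤b b≤c))
    u≤c+b : u ℕ.≤ c ℕ.+ b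
    u≤c+b = ℕ.≤-trans (∣i+j∣≤∣i∣+∣j∣ (+ c) t) (ℕ.+-monoʳ-≤ c ∣t∣≤b)
    a≡u : a ≡ u
    a≡u = ≡-mod⇒≡ a<N (ℕ.≤-<-trans u≤c+b c+b<N) (≡-mod-trans a≡c+t (≡⇒≡-mod (sym u≡c+t)))

  -- For N = 1 + 2q, multiplication by 1 + q inverts multiplication by 2 modulo N.
  half : ℤ → ℤ → ℤ
  half q x = (1ℤ + q) * x

  pos-odd : ∀ q → + suc (2 ℕ.* q) ≡ 1ℤ + + 2 * + q
  pos-odd q = trans (pos-+ 1 (2 ℕ.* q)) (cong (λ n → 1ℤ + n) (pos-* 2 q))

  module _ {N : ℕ} (q : ℤ) (N≡1+2q : + N ≡ 1ℤ + + 2 * q) where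

    half-double : ∀ z → half q (+ 2 * z) ≡ z mod N
    half-double z = begin
      (1ℤ + q) * (+ 2 * z)      ≡⟨ solve (z ∷ q ∷ []) ⟩
      z + z * (1ℤ + + 2 * q)    ≡⟨ cong (λ n → z + z * n) N≡1+2q ⟨
      z + z * + N               ≈⟨ +-multiple-mod z z ⟩
      z                         ∎
      where open ≡-mod-Reasoning N

    half-injective : ∀ {x y} → half q x ≡ half q y mod N → x ≡ y mod N
    half-injective {x} {y} hx≡hy = begin
      x                         ≈⟨ half-double x ⟨
      (1ℤ + q) * (+ 2 * x)      ≡⟨ solve (x ∷ q ∷ []) ⟩
      + 2 * ((1ℤ + q) * x)      ≈⟨ *-congˡ-mod (+ 2) hx≡hy ⟩
      + 2 * ((1ℤ + q) * y)      ≡⟨ solve (y ∷ q ∷ []) ⟩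
      (1ℤ + q) * (+ 2 * y)      ≈⟨ half-double y ⟩
      y                         ∎
      where open ≡-mod-Reasoning N

    near-half : ∀ {b x y t} → ∣ t ∣ ℕ.≤ b → x ≡ y + + 2 * t mod N → Near N b (half q x) (half q y)
    near-half {x = x} {y} {t} ∣t∣≤b x≡y+2t = near t ∣t∣≤b (begin
      (1ℤ + q) * x                          ≈⟨ *-congˡ-mod (1ℤ + q) x≡y+2t ⟩
      (1ℤ + q) * (y + + 2 * t)              ≡⟨ solve (y ∷ t ∷ q ∷ []) ⟩
      (1ℤ + q) * y + (1ℤ + q) * (+ 2 * t)   ≈⟨ +-congˡ-mod ((1ℤ + q) * y) (half-double t) ⟩
      (1ℤ + q) * y + t                      ∎)
      where open ≡-mod-Reasoning N


module CyclicWindow where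

  open import Data.Nat as ℕ using (ℕ; suc; NonZero; z≤n)
  import Data.Nat.Properties as ℕ
  open import Data.Nat.Tactic.RingSolver as ℕ-Solver using ()
  open import Data.Integer using (ℤ; +_; -_; _+_; _-_; _%ℕ_)
  open import Data.Integer.DivMod using (n%ℕd<d)
  open import Data.Integer.Tactic.RingSolver using (solve)
  open import Data.Fin using (Fin)
  open import Data.Fin.Subset using (Subset; ∣_∣; _∈_)
  open import Data.Fin.Subset.Properties using (nonempty?; Empty-unique; ∣⊥∣≡0)
  open import Data.List using (_∷_; [])
  open import Data.Product using (_,_)
  open import Relation.Nullary using (yes; no)
  open import Relation.Binary.PropositionalEquality using (_≡_; sym; trans; cong; subst)
  open SubsetCounting using (spread≤⇒∣p∣≤)
  open ModularArithmetic

  near-window⇒≤ : ∀ {N m a b} → 4 ℕ.* m ℕ.< N → a ℕ.< N → b ℕ.< N →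
                  Near N m (+ a) (+ m) → Near N m (+ b) (+ m) → Near N m (+ a) (+ b) →
                  a ℕ.≤ b ℕ.+ m
  near-window⇒≤ {N} {m} {a} {b} 4m<N a<N b<N a~m b~m a~b =
    ℕ.+-cancelʳ-≤ m a (b ℕ.+ m)
      (near⇒≤ (ℕ.m≤n+m m b) (<N (ℕ.+-monoˡ-≤ m (ℕ.+-monoˡ-≤ m b≤2m)))
        (<N (ℕ.≤-trans (ℕ.+-monoˡ-≤ m a≤2m) (ℕ.m≤m+n _ m))) (near-translate (+ m) a~b))
    where
    4m≡m+m+m+m : 4 ℕ.* m ≡ m ℕ.+ m ℕ.+ m ℕ.+ m
    4m≡m+m+m+m = ℕ-Solver.solve (m ∷ [])
    <N : ∀ {d} → d ℕ.≤ m ℕ.+ m ℕ.+ m ℕ.+ m → d ℕ.< N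
    <N d≤4m = ℕ.≤-<-trans d≤4m (subst (ℕ._< N) 4m≡m+m+m+m 4m<N)
    2m<N : m ℕ.+ m ℕ.< N
    2m<N = <N (ℕ.≤-trans (ℕ.m≤m+n _ m) (ℕ.m≤m+n _ m))
    a≤2m : a ℕ.≤ m ℕ.+ m
    a≤2m = near⇒≤ ℕ.≤-refl 2m<N a<N a~m
    b≤2m : b ℕ.≤ m ℕ.+ m
    b≤2m = near⇒≤ ℕ.≤-refl 2m<N b<N b~m

  pairwise-near⇒∣p∣≤ : ∀ {n N m} .{{_ : NonZero N}} → 4 ℕ.* m ℕ.< N →
                       (p : Subset n) (g : Fin n → ℤ) →
                       (∀ {x y} → x ∈ p → y ∈ p → g x ≡ g y mod N → x ≡ y) →
                       (∀ {x y} → x ∈ p → y ∈ p → Near N m (g x) (g y)) →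
                       ∣ p ∣ ℕ.≤ suc m
  pairwise-near⇒∣p∣≤ {n} {N} {m} 4m<N p g g-injective g-near with nonempty? p
  ... | no ¬ne = subst (ℕ._≤ suc m) (sym (trans (cong ∣_∣ (Empty-unique ¬ne)) (∣⊥∣≡0 n))) z≤n
  ... | yes (x₀ , px₀) = spread≤⇒∣p∣≤ p G (x₀ , px₀) G-injective G-spread
    where
    -- G moves p into the window [0, 2m] of residues, with x₀ at m.
    c : ℤ
    c = + m - g x₀
    G : Fin n → ℕ
    G x = (g x + c) %ℕ N
    G≡ : ∀ x → + G x ≡ g x + c mod N
    G≡ x = %ℕ-≡-mod (g x + c)
    G<N : ∀ x → G x ℕ.< N
    G<N x = n%ℕd<d (g x + c) N
    G-injective : ∀ {x y} → x ∈ p → y ∈ p → G x ≡ G y → x ≡ y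
    G-injective {x} {y} px py Gx≡Gy = g-injective px py (+-cancelʳ-mod c (begin
      g x + c    ≈⟨ G≡ x ⟨
      + G x      ≡⟨ cong +_ Gx≡Gy ⟩
      + G y      ≈⟨ G≡ y ⟩
      g y + c    ∎))
      where open ≡-mod-Reasoning N
    G-near : ∀ {x y} → x ∈ p → y ∈ p → Near N m (+ G x) (+ G y)
    G-near {x} {y} px py =
      near-resp (≡-mod-sym (G≡ x)) (≡-mod-sym (G≡ y)) (near-translate c (g-near px py))
    G-near-m : ∀ {x} → x ∈ p → Near N m (+ G x) (+ m)
    G-near-m px =
      near-resp ≡-mod-refl (≡-mod-trans (G≡ x₀) (≡⇒≡-mod (a+[b-a]≡b (g x₀) (+ m)))) (G-near px px₀)
      where
      a+[b-a]≡b : ∀ a b → a + (b - a) ≡ b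
      a+[b-a]≡b a b = solve (a ∷ b ∷ [])
    G-spread : ∀ {x y} → x ∈ p → y ∈ p → G x ℕ.≤ G y ℕ.+ m
    G-spread {x} {y} px py =
      near-window⇒≤ 4m<N (G<N x) (G<N y) (G-near-m px) (G-near-m py) (G-near px py)

module EvenCircleGraph where

  open import Data.Nat as ℕ using (ℕ; NonZero; _∸_)
  import Data.Nat.Properties as ℕ
  open import Data.Integer using (ℤ; +_; _+_; _-_; _*_; 1ℤ)
  open import Data.Integer.Properties using (m-n≡m⊖n; ⊖-≥; pos-*)
  open import Data.Integer.Tactic.RingSolver using (solve)
  open import Data.Fin using (Fin; toℕ)
  open import Data.Fin.Properties using (toℕ<n)
  open import Data.Fin.Subset using (_∈_)
  open import Data.List using (_∷_; [])
  open import Data.Product using (_,_)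
  open import Data.Sum using (inj₁; inj₂)
  open import Relation.Binary.PropositionalEquality using (_≡_; refl; sym; trans; cong; subst)
  open ModularArithmetic

  diffMod-≡-mod : ∀ {N} .{{_ : NonZero N}} (x y : Fin N) → + toℕ x ≡ + toℕ y + + diffMod N x y mod N
  diffMod-≡-mod {N} x y = begin
    + toℕ x                              ≈⟨ +-multiple-mod (+ toℕ x) 1ℤ ⟨
    + toℕ x + 1ℤ * + N                   ≡⟨ rearrange (+ toℕ x) (+ toℕ y) (+ N) ⟩
    + toℕ y + (+ (toℕ x ℕ.+ N) - + toℕ y) ≡⟨ cong (λ d → + toℕ y + d) (sym +[x+N∸y]) ⟩
    + toℕ y + + (toℕ x ℕ.+ N ∸ toℕ y)    ≈⟨ +-congˡ-mod (+ toℕ y) (%ℕ-≡-mod (+ (toℕ x ℕ.+ N ∸ toℕ y))) ⟨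
    + toℕ y + + diffMod N x y            ∎
    where
    open ≡-mod-Reasoning N
    rearrange : ∀ a b n → a + 1ℤ * n ≡ b + ((a + n) - b)
    rearrange a b n = solve (a ∷ b ∷ n ∷ [])
    +[x+N∸y] : + (toℕ x ℕ.+ N ∸ toℕ y) ≡ + (toℕ x ℕ.+ N) - + toℕ y
    +[x+N∸y] = sym (trans (m-n≡m⊖n (toℕ x ℕ.+ N) (toℕ y))
                          (⊖-≥ (ℕ.≤-trans (ℕ.<⇒≤ (toℕ<n y)) (ℕ.m≤n+m N (toℕ x)))))

  even-step : ∀ {N} .{{_ : NonZero N}} (x y : Fin N) {j} → diffMod N x y ≡ 2 ℕ.* j →
              + toℕ x ≡ + toℕ y + + 2 * + j mod N
  even-step {N} x y {j} x-y≡2j =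
    subst (λ d → + toℕ x ≡ + toℕ y + d mod N) (trans (cong +_ x-y≡2j) (pos-* 2 j)) (diffMod-≡-mod x y)

  position : ∀ {N} → ℤ → Fin N → ℤ
  position q x = half q (+ toℕ x)

  module _ {N : ℕ} .{{_ : NonZero N}} (q : ℤ) (N≡1+2q : + N ≡ 1ℤ + + 2 * q) where

    adjacent⇒near : ∀ {s x y} → CircleAdj N (EvenUpTo s) x y → Near N s (position q x) (position q y)
    adjacent⇒near {x = x} {y} (inj₁ (j , _ , j≤s , x-y≡2j)) =
      near-half q N≡1+2q {t = + j} j≤s (even-step x y {j} x-y≡2j)
    adjacent⇒near {x = x} {y} (inj₂ (j , _ , j≤s , y-x≡2j)) =
      near-sym (near-half q N≡1+2q {t = + j} j≤s (even-step y x {j} y-x≡2j))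

    diameterTwo⇒near : ∀ {s V E} → IsSubgraph (CircleAdj N (EvenUpTo s)) V E → DiameterTwo V E →
                       ∀ {x y} → x ∈ V → y ∈ V → Near N (s ℕ.+ s) (position q x) (position q y)
    diameterTwo⇒near {s} H diam {x} {y} x∈V y∈V with diam x y x∈V y∈V
    ... | inj₁ refl = near-refl
    ... | inj₂ (inj₁ xy) = near-mono (ℕ.m≤m+n s s) (adjacent⇒near (IsSubgraph.edge-adj H x y xy))
    ... | inj₂ (inj₂ (z , _ , xz , zy)) =
      near-trans (adjacent⇒near (IsSubgraph.edge-adj H x z xz))
                 (adjacent⇒near (IsSubgraph.edge-adj H z y zy))

open import Data.Nat using (ℕ; suc; _+_; _*_; _≤_; _<_; s≤s)
open import Data.Nat.Properties using (+-comm; *-comm; *-assoc; *-monoʳ-≤; +-identityʳ; ≤-reflexive)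
open import Data.Integer as ℤ using (+_; 1ℤ)
open import Data.Fin using (Fin)
open import Data.Fin.Properties using (toℕ<n; toℕ-injective)
open import Data.Fin.Subset using (Subset; ∣_∣; _∈_)
open import Relation.Binary.PropositionalEquality using (_≡_; sym; trans; cong; subst)
open ModularArithmetic using (_≡_mod_; ≡-mod⇒≡; pos-odd; half-injective; near-mono)
open CyclicWindow using (pairwise-near⇒∣p∣≤)
open EvenCircleGraph using (position; diameterTwo⇒near)

lemma7 : (s k : ℕ) → 1 ≤ s → 4 ≤ k →
         (V : Subset (suc (2 * s * k))) (E : Fin (suc (2 * s * k)) → Fin (suc (2 * s * k)) → Set) →
           IsSubgraph (CircleAdj (suc (2 * s * k)) (EvenUpTo s)) V E →
           DiameterTwo V E →
           ∣ V ∣ ≤ 2 * s + 1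
lemma7 s k _ 4≤k V E H diam =
  subst (∣ V ∣ ≤_) (+-comm 1 (2 * s))
    (pairwise-near⇒∣p∣≤ 4[2s]<N V (position q) position-injective
      (λ x∈V y∈V → near-mono s+s≤2s (diameterTwo⇒near q N≡1+2q H diam x∈V y∈V)))
  where
  q : ℤ.ℤ
  q = + (s * k)
  N≡1+2q : + suc (2 * s * k) ≡ 1ℤ ℤ.+ + 2 ℤ.* q
  N≡1+2q = trans (cong (λ n → + suc n) (*-assoc 2 s k)) (pos-odd (s * k))
  4[2s]<N : 4 * (2 * s) < suc (2 * s * k)
  4[2s]<N = s≤s (subst (_≤ 2 * s * k) (*-comm (2 * s) 4) (*-monoʳ-≤ (2 * s) 4≤k))
  s+s≤2s : s + s ≤ 2 * s
  s+s≤2s = ≤-reflexive (cong (λ n → s + n) (sym (+-identityʳ s)))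
  position-injective : ∀ {x y} → x ∈ V → y ∈ V → position q x ≡ position q y mod suc (2 * s * k) → x ≡ y
  position-injective _ _ qx≡qy =
    toℕ-injective (≡-mod⇒≡ (toℕ<n _) (toℕ<n _) (half-injective q N≡1+2q qx≡qy))
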